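{- $\mathfrak{S}(132)=\{\pi(\lambda) : \lambda \text{ an integer partition}\}$.
   Context: $\mathfrak{S}_n$ is the symmetric group on $\{1,\dots,n\}$ in one-line notation, with $\mathfrak{S}_0$ consisting of the empty permutation. A permutation $w$ avoids $132$ if there are no $i<j<k$ with $w(i)<w(k)<w(j)$. $\mathfrak{S}(132)$ is the set of all $w\in\mathfrak{S}_n$, over all $n\ge 0$, that avoid $132$ and satisfy $w(n)\ne n$ (vacuous for $n=0$). For a partition $\lambda$ (Young diagram with rows indexed top to bottom, columns left to right), the antidiagonal filling labels the square in row $r$, column $c$ by $r+c-1$; the reading word $\mathrm{read}(\lambda)=i_1\cdots i_m$ concatenates the rows' entries from the bottom row to the top row, each row read left to right; it is a reduced word. $\pi(\lambda)$ is the permutation $\sigma_{i_1}\cdots\sigma_{i_m}\in\mathfrak{S}_N$, where $\sigma_i$ is the adjacent transposition of $i,i+1$ and $N$ is one more than the largest entry of the filling; for the empty partition, $\pi(\lambda)$ is the empty permutation. For example, $\pi(7,4,4,2,1)=65472381\in\mathfrak{S}_8$ and $\pi((\ell))=23\cdots(\ell+1)1\in\mathfrak{S}_{\ell+1}$. -}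

module Defs where

open import Data.Nat using (ℕ; zero; suc; _+_; _∸_; _⊔_; _<_; _≥_)
open import Data.Fin as Fin using (Fin)
open import Data.List using (List; []; _∷_; map; upTo; length; lookup; reverse; concat; foldl; foldr; _∷ʳ_)
open import Data.List.Relation.Unary.All using (All)
open import Data.List.Relation.Unary.Linked using (Linked)
open import Data.List.Relation.Binary.Permutation.Propositional using (_↭_)
open import Data.Product using (_×_)
open import Relation.Binary.PropositionalEquality using (_≡_; _≢_)
open import Relation.Nullary using (¬_)

-- Permutations are lists of naturals in one-line notation.
-- [1, ..., n]
idPerm : ℕ → List ℕ
idPerm n = map suc (upTo n)

IsPerm : List ℕ → Set
IsPerm w = w ↭ idPerm (length w)

Avoids132 : List ℕ → Set
Avoids132 w = (i j k : Fin (length w)) → i Fin.< j → j Fin.< k →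
  ¬ (lookup w i < lookup w k × lookup w k < lookup w j)

-- w(n) ≠ n where n = length w (vacuous for the empty permutation)
LastNotFixed : List ℕ → Set
LastNotFixed w = (xs : List ℕ) (x : ℕ) → w ≡ xs ∷ʳ x → x ≢ length w

InS132 : List ℕ → Set
InS132 w = IsPerm w × Avoids132 w × LastNotFixed w

IsPartition : List ℕ → Set
IsPartition λs = All (λ p → 0 < p) λs × Linked _≥_ λs

-- entries of row r (1-indexed) of length l in the antidiagonal filling:
-- r + c - 1 for c = 1..l, i.e. r, r+1, …, r+l-1
rowEntries : ℕ → ℕ → List ℕ
rowEntries r l = map (λ c → r + c) (upTo l)

rowsFrom : ℕ → List ℕ → List (List ℕ)
rowsFrom r [] = []
rowsFrom r (l ∷ ls) = rowEntries r l ∷ rowsFrom (suc r) ls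

readWord : List ℕ → List ℕ
readWord λs = concat (reverse (rowsFrom 1 λs))

sizeOf : List ℕ → ℕ
sizeOf λs with readWord λs
... | [] = 0
... | e ∷ es = suc (foldr _⊔_ e es)

-- right multiplication by σ_i in one-line notation: swap positions i, i+1 (1-indexed)
swapAt : ℕ → List ℕ → List ℕ
swapAt (suc zero) (a ∷ b ∷ xs) = b ∷ a ∷ xs
swapAt (suc (suc k)) (x ∷ xs) = x ∷ swapAt (suc k) xs
swapAt _ xs = xs

-- π(λ) = σ_{i₁} ⋯ σ_{i_m} ∈ 𝔖_N, one-line notation
piOf : List ℕ → List ℕ
piOf λs = foldl (λ w i → swapAt i w) (idPerm (sizeOf λs)) (readWord λs)

-- Write λ = (l, λ′). The reading word of λ is that of λ′ with every letter raised by one, followed by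
-- the top row 1 2 ⋯ l. The raised letters move the entries of a raised π(λ′) (padded with fixed
-- points up to length l) and leave the new first entry 1 alone, which the top row then carries to
-- position l + 1. For a partition, l ≥ λ′₁, so everything after this 1 increases; by induction π(λ)
-- avoids 132, and its last value is 1 or one more than the last value of π(λ′), hence never fixed.
-- Conversely, in w ∈ 𝔖(132) everything after the 1 exceeds it, so avoiding 132 forces it to increase.
-- Deleting the 1, lowering all entries by one and stripping the trailing fixed points leaves a
-- shorter w′ ∈ 𝔖(132), which is π(λ′) by induction. The 1 of w′ sits at index λ′₁, which forces
-- λ′₁ ≤ l for the index l of the 1 in w, and l > 0 since an ascending permutation is the identity.

module Submission where

open import Defs
open import Data.Empty using (⊥-elim)
open import Data.Fin as F using (Fin)
open import Data.List
  using ( List; []; _∷_; _++_; _∷ʳ_; [_]; map; take; drop; length; foldl; foldr; lookup; last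
        ; concat; reverse; applyUpTo; upTo; initLast; _∷ʳ′_ )
open import Data.List.Properties
  using ( map-++; map-∘; map-id; map-id-local; length-map; length-++; length-++-≤ˡ; length-++-sucʳ
        ; ++-assoc; ++-identityʳ; take++drop≡id; drop-map; drop-drop; drop-all; length-take; foldl-++
        ; last-map; map-upTo; unfold-reverse; concat-++; reverse-map; concat-map; ∷-injectiveʳ )
open import Data.List.Membership.Propositional using (_∈_)
open import Data.List.Membership.Propositional.Properties using (∈-∃++; ∈-++⁺ʳ; ∈-lookup)
open import Data.List.Relation.Binary.Permutation.Propositional using (_↭_; prep; ↭-trans; ↭-sym; ↭-refl)
open import Data.List.Relation.Binary.Permutation.Propositional.Properties
  using (All-resp-↭; ∈-resp-↭; shift; drop-mid; ↭-length; ↭-empty-inv)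
  renaming (map⁺ to ↭-map⁺; ++⁺ʳ to ↭-++⁺ʳ)
open import Data.List.Relation.Binary.Sublist.Propositional as Sublist using (_⊆_; []; _∷_; ⊆-refl)
import Data.List.Relation.Binary.Sublist.Propositional.Properties as Sublist
open import Data.List.Relation.Unary.All as All using (All; []; _∷_)
import Data.List.Relation.Unary.All.Properties as All
open import Data.List.Relation.Unary.AllPairs as AllPairs using (AllPairs; []; _∷_)
import Data.List.Relation.Unary.AllPairs.Properties as AllPairs
open import Data.List.Relation.Unary.Any using (here)
open import Data.List.Relation.Unary.Linked as Linked using (Linked; []; [-]; _∷_)
import Data.Maybe as Maybe
open import Data.Maybe using (just)
open import Data.Maybe.Properties using (just-injective; map-injective)
open import Data.Nat
open import Data.Nat.Induction using (<-wellFounded)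
open import Data.Nat.Properties
open import Algebra.Properties.CommutativeSemigroup ⊔-commutativeSemigroup
  using () renaming (x∙yz≈y∙xz to ⊔-left-comm)
open import Data.Product using (Σ; ∃₂; _×_; _,_; proj₂)
open import Function using (_∘_)
open import Function.Bundles using (_⇔_; mk⇔; module Equivalence)
open import Induction.WellFounded using (Acc; acc)
open import Relation.Binary using (Rel)
open import Relation.Binary.PropositionalEquality
  using (_≡_; _≢_; refl; sym; trans; cong; cong₂; subst; subst₂; module ≡-Reasoning)
open import Relation.Nullary using (yes; no)

module _ {a} {A : Set a} where

  last-∷ʳ : ∀ (xs : List A) x → last (xs ∷ʳ x) ≡ just x
  last-∷ʳ []           x = refl
  last-∷ʳ (y ∷ [])     x = refl
  last-∷ʳ (y ∷ z ∷ xs) x = last-∷ʳ (z ∷ xs) x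

  last-++-∷ : ∀ (xs : List A) {y} ys → last (xs ++ y ∷ ys) ≡ last (y ∷ ys)
  last-++-∷ []            ys = refl
  last-++-∷ (x ∷ [])      ys = refl
  last-++-∷ (x ∷ x′ ∷ xs) ys = last-++-∷ (x′ ∷ xs) ys

  drop-++ˡ : ∀ n (xs ys : List A) → n ≤ length xs → drop n (xs ++ ys) ≡ drop n xs ++ ys
  drop-++ˡ zero    xs       ys _  = refl
  drop-++ˡ (suc n) (x ∷ xs) ys n≤ = drop-++ˡ n xs ys (s≤s⁻¹ n≤)

  insert : ℕ → A → List A → List A
  insert l x u = take l u ++ x ∷ drop l u

  insert-↭ : ∀ l x u → insert l x u ↭ x ∷ u
  insert-↭ l x u = subst (λ v → insert l x u ↭ x ∷ v) (take++drop≡id l u) (shift x (take l u) (drop l u))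

  insert-++ : ∀ xs x ys → insert (length xs) x (xs ++ ys) ≡ xs ++ x ∷ ys
  insert-++ []       x ys = refl
  insert-++ (y ∷ xs) x ys = cong (y ∷_) (insert-++ xs x ys)

  drop-insert : ∀ l x u → l ≤ length u → drop l (insert l x u) ≡ x ∷ drop l u
  drop-insert zero    x u       _  = refl
  drop-insert (suc l) x (y ∷ u) l≤ = drop-insert l x u (s≤s⁻¹ l≤)

  last-insert-end : ∀ l x u → length u ≤ l → last (insert l x u) ≡ just x
  last-insert-end l x u u≤l = trans (last-++-∷ (take l u) (drop l u)) (cong (λ d → last (x ∷ d)) (drop-all l u u≤l))

  last-insert-< : ∀ l x u → l < length u → last (insert l x u) ≡ last u
  last-insert-< zero          x (y ∷ u)     _  = refl
  last-insert-< (suc zero)    x (y ∷ z ∷ u) _  = refl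
  last-insert-< (suc (suc l)) x (y ∷ z ∷ u) l< = last-insert-< (suc l) x (z ∷ u) (s≤s⁻¹ l<)
  last-insert-< (suc l)       x (y ∷ [])    (s≤s ())

  module _ {r} {R : Rel A r} where

    open F using (zero; suc)

    AllPairs-resp-⊆ : ∀ {xs ys} → xs ⊆ ys → AllPairs R ys → AllPairs R xs
    AllPairs-resp-⊆ []                 []         = []
    AllPairs-resp-⊆ (y Sublist.∷ʳ xs⊆) (_ ∷ Rys)  = AllPairs-resp-⊆ xs⊆ Rys
    AllPairs-resp-⊆ (refl ∷ xs⊆)       (Ry ∷ Rys) = Sublist.All-resp-⊆ xs⊆ Ry ∷ AllPairs-resp-⊆ xs⊆ Rys

    AllPairs⇒lookup : ∀ {xs} → AllPairs R xs →
                      (j k : Fin (length xs)) → j F.< k → R (lookup xs j) (lookup xs k)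
    AllPairs⇒lookup (Rx ∷ _)  zero    (suc k) _   = All.lookup Rx (∈-lookup k)
    AllPairs⇒lookup (_ ∷ Rxs) (suc j) (suc k) j<k = AllPairs⇒lookup Rxs j k (s≤s⁻¹ j<k)

    lookup⇒AllPairs : ∀ xs → (∀ (j k : Fin (length xs)) → j F.< k → R (lookup xs j) (lookup xs k)) →
                      AllPairs R xs
    lookup⇒AllPairs []       _   = []
    lookup⇒AllPairs (x ∷ xs) Rjk = head xs (λ k → Rjk zero (suc k) z<s)
                                 ∷ lookup⇒AllPairs xs (λ j k j<k → Rjk (suc j) (suc k) (s<s j<k))
      where
      head : ∀ ys → (∀ k → R x (lookup ys k)) → All (R x) ys
      head []       _   = []
      head (y ∷ ys) Rxk = Rxk zero ∷ head ys (Rxk ∘ suc)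

    AllPairs-insert : ∀ xs {z ys} → AllPairs R (xs ++ ys) → All (λ x → R x z) xs → All (R z) ys →
                      AllPairs R (xs ++ z ∷ ys)
    AllPairs-insert []       Rys         []           Rzys = Rzys ∷ Rys
    AllPairs-insert (x ∷ xs) (Rx ∷ Rxys) (Rxz ∷ Rxsz) Rzys =
      All.++⁺ (All.++⁻ˡ xs Rx) (Rxz ∷ All.++⁻ʳ xs Rx) ∷ AllPairs-insert xs Rxys Rxsz Rzys

    AllPairs-∷ʳ⁻ : ∀ xs {z} → AllPairs R (xs ∷ʳ z) → All (λ x → R x z) xs
    AllPairs-∷ʳ⁻ []       _          = []
    AllPairs-∷ʳ⁻ (x ∷ xs) (Rx ∷ Rxs) = proj₂ (All.∷ʳ⁻ Rx) ∷ AllPairs-∷ʳ⁻ xs Rxs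

    AllPairs-drop-mono : ∀ {m n} xs → m ≤ n → AllPairs R (drop m xs) → AllPairs R (drop n xs)
    AllPairs-drop-mono {m = m} {n} xs m≤n asc =
      subst (AllPairs _) (trans (drop-drop m (n ∸ m) xs) (cong (λ k → drop k xs) (m+[n∸m]≡n m≤n)))
            (AllPairs.drop⁺ (n ∸ m) asc)

interval : ℕ → ℕ → List ℕ
interval a zero    = []
interval a (suc k) = suc a ∷ interval (suc a) k

length-interval : ∀ a k → length (interval a k) ≡ k
length-interval a zero    = refl
length-interval a (suc k) = cong suc (length-interval (suc a) k)

interval-++ : ∀ a m k → interval a (m + k) ≡ interval a m ++ interval (a + m) k
interval-++ a zero    k = cong (λ b → interval b k) (sym (+-identityʳ a))
interval-++ a (suc m) k =
  cong (suc a ∷_) (trans (interval-++ (suc a) m k) (cong (λ b → interval (suc a) m ++ interval b k) (sym (+-suc a m))))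

map-suc-interval : ∀ a k → map suc (interval a k) ≡ interval (suc a) k
map-suc-interval a zero    = refl
map-suc-interval a (suc k) = cong (suc (suc a) ∷_) (map-suc-interval (suc a) k)

interval-> : ∀ a k → All (a <_) (interval a k)
interval-> a zero    = []
interval-> a (suc k) = ≤-refl ∷ All.map (<-trans (n<1+n a)) (interval-> (suc a) k)

interval-≤ : ∀ a k → All (_≤ a + k) (interval a k)
interval-≤ a zero    = []
interval-≤ a (suc k) = subst (λ b → All (_≤ b) (interval a (suc k))) (sym (+-suc a k))
                         (s≤s (m≤m+n a k) ∷ interval-≤ (suc a) k)

interval-ascending : ∀ a k → AllPairs _≤_ (interval a k)
interval-ascending a zero    = []
interval-ascending a (suc k) = All.map <⇒≤ (interval-> (suc a) k) ∷ interval-ascending (suc a) k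

last-interval : ∀ a k → last (interval a (suc k)) ≡ just (a + suc k)
last-interval a zero    = cong just (sym (+-comm a 1))
last-interval a (suc k) = trans (last-interval (suc a) k) (cong just (sym (+-suc a (suc k))))

idPerm≡interval : ∀ n → idPerm n ≡ interval 0 n
idPerm≡interval n = trans (map-upTo suc n) (applyUpTo≡interval suc 0 n (λ _ → refl))
  where
  applyUpTo≡interval : ∀ f a k → (∀ i → f i ≡ suc (a + i)) → applyUpTo f k ≡ interval a k
  applyUpTo≡interval f a zero    f≗ = refl
  applyUpTo≡interval f a (suc k) f≗ =
    cong₂ _∷_ (trans (f≗ 0) (cong suc (+-identityʳ a)))
              (applyUpTo≡interval (f ∘ suc) (suc a) k (λ i → trans (f≗ (suc i)) (cong suc (+-suc a i))))

length-idPerm : ∀ n → length (idPerm n) ≡ n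
length-idPerm n = trans (cong length (idPerm≡interval n)) (length-interval 0 n)

idPerm-suc : ∀ n → idPerm (suc n) ≡ 1 ∷ map suc (idPerm n)
idPerm-suc n = begin
  idPerm (suc n)              ≡⟨ idPerm≡interval (suc n) ⟩
  1 ∷ interval 1 n            ≡⟨ cong (1 ∷_) (sym (map-suc-interval 0 n)) ⟩
  1 ∷ map suc (interval 0 n)  ≡⟨ cong (λ xs → 1 ∷ map suc xs) (sym (idPerm≡interval n)) ⟩
  1 ∷ map suc (idPerm n)      ∎
  where open ≡-Reasoning

idPerm-∷ʳ : ∀ n → idPerm (suc n) ≡ idPerm n ∷ʳ suc n
idPerm-∷ʳ n = begin
  idPerm (suc n)              ≡⟨ idPerm≡interval (suc n) ⟩
  interval 0 (suc n)          ≡⟨ cong (interval 0) (+-comm 1 n) ⟩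
  interval 0 (n + 1)          ≡⟨ interval-++ 0 n 1 ⟩
  interval 0 n ∷ʳ suc n       ≡⟨ cong (_∷ʳ suc n) (sym (idPerm≡interval n)) ⟩
  idPerm n ∷ʳ suc n           ∎
  where open ≡-Reasoning

↭-idPerm-positive : ∀ {w n} → w ↭ idPerm n → All (0 <_) w
↭-idPerm-positive {n = n} w↭ =
  All-resp-↭ (↭-sym w↭) (subst (All (0 <_)) (sym (idPerm≡interval n)) (interval-> 0 n))

↭-idPerm-≤ : ∀ {w n} → w ↭ idPerm n → All (_≤ n) w
↭-idPerm-≤ {n = n} w↭ =
  All-resp-↭ (↭-sym w↭) (subst (All (_≤ n)) (sym (idPerm≡interval n)) (interval-≤ 0 n))

-- Adjacent transpositions and the recursion for π

applySwaps : List ℕ → List ℕ → List ℕ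
applySwaps = foldl (λ w i → swapAt i w)

swapAt-map : ∀ (f : ℕ → ℕ) i xs → swapAt i (map f xs) ≡ map f (swapAt i xs)
swapAt-map f zero          xs           = refl
swapAt-map f (suc zero)    []           = refl
swapAt-map f (suc zero)    (x ∷ [])     = refl
swapAt-map f (suc zero)    (x ∷ y ∷ xs) = refl
swapAt-map f (suc (suc i)) []           = refl
swapAt-map f (suc (suc i)) (x ∷ xs)     = cong (f x ∷_) (swapAt-map f (suc i) xs)

length-swapAt : ∀ i xs → length (swapAt i xs) ≡ length xs
length-swapAt zero          xs           = refl
length-swapAt (suc zero)    []           = refl
length-swapAt (suc zero)    (x ∷ [])     = refl
length-swapAt (suc zero)    (x ∷ y ∷ xs) = refl
length-swapAt (suc (suc i)) []           = refl
length-swapAt (suc (suc i)) (x ∷ xs)     = cong suc (length-swapAt (suc i) xs)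

swapAt-++ : ∀ i xs ys → i < length xs → swapAt i (xs ++ ys) ≡ swapAt i xs ++ ys
swapAt-++ zero          xs           ys _   = refl
swapAt-++ (suc zero)    (x ∷ [])     ys (s≤s ())
swapAt-++ (suc zero)    (x ∷ y ∷ xs) ys _   = refl
swapAt-++ (suc (suc i)) (x ∷ xs)     ys i<  = cong (x ∷_) (swapAt-++ (suc i) xs ys (s≤s⁻¹ i<))

applySwaps-map : ∀ (f : ℕ → ℕ) xs is → applySwaps (map f xs) is ≡ map f (applySwaps xs is)
applySwaps-map f xs []       = refl
applySwaps-map f xs (i ∷ is) =
  trans (cong (λ ys → applySwaps ys is) (swapAt-map f i xs)) (applySwaps-map f (swapAt i xs) is)

length-applySwaps : ∀ xs is → length (applySwaps xs is) ≡ length xs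
length-applySwaps xs []       = refl
length-applySwaps xs (i ∷ is) = trans (length-applySwaps (swapAt i xs) is) (length-swapAt i xs)

applySwaps-++ : ∀ xs ys is → All (_< length xs) is → applySwaps (xs ++ ys) is ≡ applySwaps xs is ++ ys
applySwaps-++ xs ys []       _            = refl
applySwaps-++ xs ys (i ∷ is) (i< ∷ is<) =
  trans (cong (λ zs → applySwaps zs is) (swapAt-++ i xs ys i<))
        (applySwaps-++ (swapAt i xs) ys is (subst (λ n → All (_< n) is) (sym (length-swapAt i xs)) is<))

applySwaps-∷ : ∀ x xs is → All (0 <_) is → applySwaps (x ∷ xs) (map suc is) ≡ x ∷ applySwaps xs is
applySwaps-∷ x xs []            _          = refl
applySwaps-∷ x xs (suc i ∷ is) (_ ∷ is>0) = applySwaps-∷ x (swapAt (suc i) xs) is is>0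

applySwaps-interval : ∀ x u l → l ≤ length u → applySwaps (x ∷ u) (interval 0 l) ≡ insert l x u
applySwaps-interval x u       zero    _  = refl
applySwaps-interval x (y ∷ u) (suc l) l≤ = begin
  applySwaps (y ∷ x ∷ u) (interval 1 l)               ≡⟨ cong (applySwaps (y ∷ x ∷ u)) (sym (map-suc-interval 0 l)) ⟩
  applySwaps (y ∷ x ∷ u) (map suc (interval 0 l))     ≡⟨ applySwaps-∷ y (x ∷ u) (interval 0 l) (interval-> 0 l) ⟩
  y ∷ applySwaps (x ∷ u) (interval 0 l)               ≡⟨ cong (y ∷_) (applySwaps-interval x u l (s≤s⁻¹ l≤)) ⟩
  y ∷ insert l x u                                     ∎
  where open ≡-Reasoning

rowEntries-suc : ∀ r l → rowEntries (suc r) l ≡ map suc (rowEntries r l)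
rowEntries-suc r l = map-∘ (upTo l)

rowsFrom-suc : ∀ r ls → rowsFrom (suc r) ls ≡ map (map suc) (rowsFrom r ls)
rowsFrom-suc r []       = refl
rowsFrom-suc r (l ∷ ls) = cong₂ _∷_ (rowEntries-suc r l) (rowsFrom-suc (suc r) ls)

readWord-∷ : ∀ l ls → readWord (l ∷ ls) ≡ map suc (readWord ls) ++ interval 0 l
readWord-∷ l ls = begin
  concat (reverse (rowEntries 1 l ∷ rowsFrom 2 ls))
    ≡⟨ cong concat (unfold-reverse (rowEntries 1 l) (rowsFrom 2 ls)) ⟩
  concat (reverse (rowsFrom 2 ls) ∷ʳ rowEntries 1 l)
    ≡⟨ sym (concat-++ (reverse (rowsFrom 2 ls)) [ rowEntries 1 l ]) ⟩
  concat (reverse (rowsFrom 2 ls)) ++ (idPerm l ++ [])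
    ≡⟨ cong₂ _++_ (cong (concat ∘ reverse) (rowsFrom-suc 1 ls)) (++-identityʳ (idPerm l)) ⟩
  concat (reverse (map (map suc) (rowsFrom 1 ls))) ++ idPerm l
    ≡⟨ cong₂ _++_ (cong concat (sym (reverse-map (map suc) (rowsFrom 1 ls)))) (idPerm≡interval l) ⟩
  concat (map (map suc) (reverse (rowsFrom 1 ls))) ++ interval 0 l
    ≡⟨ cong (_++ interval 0 l) (concat-map (reverse (rowsFrom 1 ls))) ⟩
  map suc (readWord ls) ++ interval 0 l
    ∎
  where open ≡-Reasoning

readWord-positive : ∀ ls → All (0 <_) (readWord ls)
readWord-positive []       = []
readWord-positive (l ∷ ls) = subst (All (0 <_)) (sym (readWord-∷ l ls))
  (All.++⁺ (All.map⁺ (All.map (λ _ → z<s) (readWord-positive ls))) (interval-> 0 l))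

maximum : List ℕ → ℕ
maximum = foldr _⊔_ 0

maximum-++ : ∀ xs ys → maximum (xs ++ ys) ≡ maximum xs ⊔ maximum ys
maximum-++ []       ys = refl
maximum-++ (x ∷ xs) ys = trans (cong (x ⊔_) (maximum-++ xs ys)) (sym (⊔-assoc x (maximum xs) (maximum ys)))

maximum-map-suc : ∀ xs l → maximum (map suc xs) ⊔ suc l ≡ suc (maximum xs ⊔ l)
maximum-map-suc []       l = refl
maximum-map-suc (x ∷ xs) l =
  trans (⊔-assoc (suc x) (maximum (map suc xs)) (suc l))
        (trans (cong (suc x ⊔_) (maximum-map-suc xs l)) (cong suc (sym (⊔-assoc x (maximum xs) l))))

maximum-interval : ∀ a k → maximum (interval a (suc k)) ≡ a + suc k
maximum-interval a zero    = trans (⊔-identityʳ (suc a)) (+-comm 1 a)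
maximum-interval a (suc k) =
  trans (cong (suc a ⊔_) (maximum-interval (suc a) k))
        (trans (m≤n⇒m⊔n≡n (s≤s (m≤m+n a (suc k)))) (sym (+-suc a (suc k))))

all-<-maximum-suc : ∀ xs → All (_< maximum (map suc xs)) xs
all-<-maximum-suc []       = []
all-<-maximum-suc (x ∷ xs) = m≤m⊔n (suc x) (maximum (map suc xs))
  ∷ All.map (λ x< → ≤-trans x< (m≤n⊔m (suc x) (maximum (map suc xs)))) (all-<-maximum-suc xs)

sizeOf-maximum : ∀ ls → sizeOf ls ≡ maximum (map suc (readWord ls))
sizeOf-maximum ls with readWord ls
... | []     = refl
... | e ∷ es = suc-foldr e es
  where
  suc-foldr : ∀ e es → suc (foldr _⊔_ e es) ≡ suc e ⊔ maximum (map suc es)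
  suc-foldr e []       = sym (⊔-identityʳ (suc e))
  suc-foldr e (x ∷ xs) =
    trans (cong (suc x ⊔_) (suc-foldr e xs)) (⊔-left-comm (suc x) (suc e) (maximum (map suc xs)))

readWord-<-sizeOf : ∀ ls → All (_< sizeOf ls) (readWord ls)
readWord-<-sizeOf ls =
  subst (λ n → All (_< n) (readWord ls)) (sym (sizeOf-maximum ls)) (all-<-maximum-suc (readWord ls))

sizeOf-∷ : ∀ {l} ls → 0 < l → sizeOf (l ∷ ls) ≡ suc (sizeOf ls ⊔ l)
sizeOf-∷ {suc l} ls _ = begin
  sizeOf (suc l ∷ ls)
    ≡⟨ sizeOf-maximum (suc l ∷ ls) ⟩
  maximum (map suc (readWord (suc l ∷ ls)))
    ≡⟨ cong (maximum ∘ map suc) (readWord-∷ (suc l) ls) ⟩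
  maximum (map suc (map suc rw ++ interval 0 (suc l)))
    ≡⟨ cong maximum (map-++ suc (map suc rw) (interval 0 (suc l))) ⟩
  maximum (map suc (map suc rw) ++ map suc (interval 0 (suc l)))
    ≡⟨ maximum-++ (map suc (map suc rw)) (map suc (interval 0 (suc l))) ⟩
  maximum (map suc (map suc rw)) ⊔ maximum (map suc (interval 0 (suc l)))
    ≡⟨ cong (λ xs → maximum (map suc (map suc rw)) ⊔ maximum xs) (map-suc-interval 0 (suc l)) ⟩
  maximum (map suc (map suc rw)) ⊔ maximum (interval 1 (suc l))
    ≡⟨ cong (maximum (map suc (map suc rw)) ⊔_) (maximum-interval 1 l) ⟩
  maximum (map suc (map suc rw)) ⊔ suc (suc l)
    ≡⟨ maximum-map-suc (map suc rw) (suc l) ⟩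
  suc (maximum (map suc rw) ⊔ suc l)
    ≡⟨ cong (λ n → suc (n ⊔ suc l)) (sym (sizeOf-maximum ls)) ⟩
  suc (sizeOf ls ⊔ suc l)
    ∎
  where
  open ≡-Reasoning
  rw : List ℕ
  rw = readWord ls

length-piOf : ∀ ls → length (piOf ls) ≡ sizeOf ls
length-piOf ls = trans (length-applySwaps (idPerm (sizeOf ls)) (readWord ls)) (length-idPerm (sizeOf ls))

⊔≡+∸ : ∀ m n → m ⊔ n ≡ m + (n ∸ m)
⊔≡+∸ zero    n       = refl
⊔≡+∸ (suc m) zero    = cong suc (sym (+-identityʳ m))
⊔≡+∸ (suc m) (suc n) = cong suc (⊔≡+∸ m n)

lifted : List ℕ → ℕ → List ℕ
lifted ls l = map suc (piOf ls ++ interval (sizeOf ls) (l ∸ sizeOf ls))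

length-lifted : ∀ ls l → length (lifted ls l) ≡ sizeOf ls ⊔ l
length-lifted ls l = begin
  length (map suc (piOf ls ++ interval S (l ∸ S)))  ≡⟨ length-map suc (piOf ls ++ interval S (l ∸ S)) ⟩
  length (piOf ls ++ interval S (l ∸ S))            ≡⟨ length-++ (piOf ls) ⟩
  length (piOf ls) + length (interval S (l ∸ S))    ≡⟨ cong₂ _+_ (length-piOf ls) (length-interval S (l ∸ S)) ⟩
  S + (l ∸ S)                                       ≡⟨ ⊔≡+∸ S l ⟨
  S ⊔ l                                             ∎
  where
  open ≡-Reasoning
  S : ℕ
  S = sizeOf ls

l≤length-lifted : ∀ l ls → l ≤ length (lifted ls l)
l≤length-lifted l ls = subst (l ≤_) (sym (length-lifted ls l)) (m≤n⊔m (sizeOf ls) l)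

idPerm-suc-⊔ : ∀ S l → idPerm (suc (S ⊔ l)) ≡ 1 ∷ map suc (idPerm S ++ interval S (l ∸ S))
idPerm-suc-⊔ S l = begin
  idPerm (suc (S ⊔ l))                                ≡⟨ idPerm-suc (S ⊔ l) ⟩
  1 ∷ map suc (idPerm (S ⊔ l))                        ≡⟨ cong (λ n → 1 ∷ map suc (idPerm n)) (⊔≡+∸ S l) ⟩
  1 ∷ map suc (idPerm (S + (l ∸ S)))                  ≡⟨ cong (λ xs → 1 ∷ map suc xs) (idPerm≡interval (S + (l ∸ S))) ⟩
  1 ∷ map suc (interval 0 (S + (l ∸ S)))              ≡⟨ cong (λ xs → 1 ∷ map suc xs) (interval-++ 0 S (l ∸ S)) ⟩
  1 ∷ map suc (interval 0 S ++ interval S (l ∸ S))    ≡⟨ cong (λ xs → 1 ∷ map suc (xs ++ interval S (l ∸ S))) (sym (idPerm≡interval S)) ⟩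
  1 ∷ map suc (idPerm S ++ interval S (l ∸ S))        ∎
  where open ≡-Reasoning

piOf-∷ : ∀ {l} ls → 0 < l → piOf (l ∷ ls) ≡ insert l 1 (lifted ls l)
piOf-∷ {l} ls 0<l = begin
  piOf (l ∷ ls)
    ≡⟨ cong₂ (λ n is → applySwaps (idPerm n) is) (sizeOf-∷ ls 0<l) (readWord-∷ l ls) ⟩
  applySwaps (idPerm (suc (S ⊔ l))) (map suc rw ++ interval 0 l)
    ≡⟨ foldl-++ (λ w i → swapAt i w) (idPerm (suc (S ⊔ l))) (map suc rw) (interval 0 l) ⟩
  applySwaps (applySwaps (idPerm (suc (S ⊔ l))) (map suc rw)) (interval 0 l)
    ≡⟨ cong (λ w → applySwaps (applySwaps w (map suc rw)) (interval 0 l)) (idPerm-suc-⊔ S l) ⟩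
  applySwaps (applySwaps (1 ∷ map suc (idPerm S ++ I)) (map suc rw)) (interval 0 l)
    ≡⟨ cong (λ w → applySwaps w (interval 0 l)) (applySwaps-∷ 1 _ rw (readWord-positive ls)) ⟩
  applySwaps (1 ∷ applySwaps (map suc (idPerm S ++ I)) rw) (interval 0 l)
    ≡⟨ cong (λ w → applySwaps (1 ∷ w) (interval 0 l)) (applySwaps-map suc (idPerm S ++ I) rw) ⟩
  applySwaps (1 ∷ map suc (applySwaps (idPerm S ++ I) rw)) (interval 0 l)
    ≡⟨ cong (λ w → applySwaps (1 ∷ map suc w) (interval 0 l)) (applySwaps-++ (idPerm S) I rw rw<) ⟩
  applySwaps (1 ∷ lifted ls l) (interval 0 l)
    ≡⟨ applySwaps-interval 1 (lifted ls l) l (l≤length-lifted l ls) ⟩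
  insert l 1 (lifted ls l)
    ∎
  where
  open ≡-Reasoning
  S : ℕ
  S = sizeOf ls
  I : List ℕ
  I = interval S (l ∸ S)
  rw : List ℕ
  rw = readWord ls
  rw< : All (_< length (idPerm S)) rw
  rw< = subst (λ n → All (_< n) rw) (sym (length-idPerm S)) (readWord-<-sizeOf ls)

-- 132-avoidance

-- No132 x y z says that x, y, z (in this order) is not a 132 pattern: ¬ (x < z < y).
No132 : ℕ → ℕ → ℕ → Set
No132 x y z = x < z → y ≤ z

data Avoiding132 : List ℕ → Set where
  []  : Avoiding132 []
  _∷_ : ∀ {x xs} → AllPairs (No132 x) xs → Avoiding132 xs → Avoiding132 (x ∷ xs)

Avoids132⇔Avoiding132 : ∀ w → Avoids132 w ⇔ Avoiding132 w
Avoids132⇔Avoiding132 w = mk⇔ (to w) from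
  where
  open F using (zero; suc)
  to : ∀ w → Avoids132 w → Avoiding132 w
  to []       _   = []
  to (x ∷ xs) avs =
    lookup⇒AllPairs xs (λ j k j<k x<z → ≮⇒≥ (λ z<y → avs zero (suc j) (suc k) z<s (s<s j<k) (x<z , z<y)))
    ∷ to xs (λ i j k i<j j<k → avs (suc i) (suc j) (suc k) (s<s i<j) (s<s j<k))
  from : ∀ {w} → Avoiding132 w → Avoids132 w
  from (x⋯ ∷ _)  zero    (suc j) (suc k) _   j<k (x<z , z<y) =
    <⇒≱ z<y (AllPairs⇒lookup x⋯ j k (s<s⁻¹ j<k) x<z)
  from (_ ∷ av) (suc i) (suc j) (suc k) i<j j<k = from av i j k (s<s⁻¹ i<j) (s<s⁻¹ j<k)
  from (_ ∷ _)  zero    zero    _       ()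
  from (_ ∷ _)  zero    (suc j) zero    _   ()
  from (_ ∷ _)  (suc i) zero    _       ()
  from (_ ∷ _)  (suc i) (suc j) zero    _   ()

Avoiding132-resp-⊆ : ∀ {xs ys} → xs ⊆ ys → Avoiding132 ys → Avoiding132 xs
Avoiding132-resp-⊆ []                 []        = []
Avoiding132-resp-⊆ (y Sublist.∷ʳ xs⊆) (_ ∷ av)  = Avoiding132-resp-⊆ xs⊆ av
Avoiding132-resp-⊆ (refl ∷ xs⊆)       (y⋯ ∷ av) = AllPairs-resp-⊆ xs⊆ y⋯ ∷ Avoiding132-resp-⊆ xs⊆ av

Avoiding132-map-suc⁺ : ∀ {xs} → Avoiding132 xs → Avoiding132 (map suc xs)
Avoiding132-map-suc⁺ []         = []
Avoiding132-map-suc⁺ (x⋯ ∷ av) =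
  AllPairs.map⁺ (AllPairs.map (λ yz x<z → s≤s (yz (s≤s⁻¹ x<z))) x⋯) ∷ Avoiding132-map-suc⁺ av

Avoiding132-map-suc⁻ : ∀ xs → Avoiding132 (map suc xs) → Avoiding132 xs
Avoiding132-map-suc⁻ []       []         = []
Avoiding132-map-suc⁻ (x ∷ xs) (x⋯ ∷ av) =
  AllPairs.map (λ yz x<z → s≤s⁻¹ (yz (s≤s x<z))) (AllPairs.map⁻ x⋯) ∷ Avoiding132-map-suc⁻ xs av

ascending⇒Avoiding132 : ∀ {xs} → AllPairs _≤_ xs → Avoiding132 xs
ascending⇒Avoiding132 []          = []
ascending⇒Avoiding132 (_ ∷ asc) = AllPairs.map (λ y≤z _ → y≤z) asc ∷ ascending⇒Avoiding132 asc

Avoiding132-++ : ∀ {xs ys b} → Avoiding132 xs → All (_≤ b) xs → All (b <_) ys → AllPairs _≤_ ys →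
                 Avoiding132 (xs ++ ys)
Avoiding132-++ []          []           _    asc = ascending⇒Avoiding132 asc
Avoiding132-++ (x⋯ ∷ av) (_ ∷ xs≤b) ys>b asc =
  AllPairs.++⁺ x⋯ (AllPairs.map (λ y≤z _ → y≤z) asc)
               (All.map (λ y≤b → All.map (λ b<z _ → ≤-trans y≤b (<⇒≤ b<z)) ys>b) xs≤b)
  ∷ Avoiding132-++ av xs≤b ys>b asc

Avoiding132-insert-min : ∀ xs {c ys} → All (c ≤_) (xs ++ ys) → AllPairs _≤_ ys →
                         Avoiding132 (xs ++ ys) → Avoiding132 (xs ++ c ∷ ys)
Avoiding132-insert-min []       _            asc av = AllPairs.map (λ y≤z _ → y≤z) asc ∷ av
Avoiding132-insert-min (x ∷ xs) (c≤x ∷ c≤) asc (x⋯ ∷ av) =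
  AllPairs-insert xs x⋯ (All.tabulate λ _ x<c → ⊥-elim (<⇒≱ x<c c≤x)) (All.map (λ c≤z _ → c≤z) (All.++⁻ʳ xs c≤))
  ∷ Avoiding132-insert-min xs c≤ asc av

Avoiding132⇒ascending : ∀ {c ys} → Avoiding132 (c ∷ ys) → All (c <_) ys → AllPairs _≤_ ys
Avoiding132⇒ascending (c⋯ ∷ _) c< = go c⋯ c<
  where
  go : ∀ {c ys} → AllPairs (No132 c) ys → All (c <_) ys → AllPairs _≤_ ys
  go []          []       = []
  go (y⋯ ∷ c⋯) (_ ∷ c<) = All.zipWith (λ (yz , c<z) → yz c<z) (y⋯ , c<) ∷ go c⋯ c<

LastNotFixed⇔ : ∀ w → LastNotFixed w ⇔ (last w ≢ just (length w))
LastNotFixed⇔ w = mk⇔ (to w) (λ last≢ xs x w≡ x≡ → last≢ (trans (cong last w≡) (trans (last-∷ʳ xs x) (cong just x≡))))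
  where
  to : ∀ w → LastNotFixed w → last w ≢ just (length w)
  to w lnf with initLast w
  ... | []       = λ ()
  ... | xs ∷ʳ′ x = λ last≡ → lnf xs x refl (just-injective (trans (sym (last-∷ʳ xs x)) last≡))

record InS132′ (w : List ℕ) : Set where
  field
    perm         : w ↭ idPerm (length w)
    avoiding     : Avoiding132 w
    lastNotFixed : last w ≢ just (length w)

InS132⇔InS132′ : ∀ w → InS132 w ⇔ InS132′ w
InS132⇔InS132′ w = mk⇔
  (λ (perm , avs , lnf) → record
    { perm = perm ; avoiding = Equivalence.to (Avoids132⇔Avoiding132 w) avs ; lastNotFixed = Equivalence.to (LastNotFixed⇔ w) lnf })
  (λ w∈ → let open InS132′ w∈ in
    perm , Equivalence.from (Avoids132⇔Avoiding132 w) avoiding , Equivalence.from (LastNotFixed⇔ w) lastNotFixed)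

-- π(λ) lies in 𝔖(132)

largestPart : List ℕ → ℕ
largestPart []      = 0
largestPart (l ∷ _) = l

largestPart-≤ : ∀ {l} ls → Linked _≥_ (l ∷ ls) → largestPart ls ≤ l
largestPart-≤ []      _   = z≤n
largestPart-≤ (_ ∷ _) lnk = Linked.head lnk

largestPart-≤-sizeOf : ∀ ls → All (0 <_) ls → largestPart ls ≤ sizeOf ls
largestPart-≤-sizeOf []       _          = z≤n
largestPart-≤-sizeOf (l ∷ ls) (0<l ∷ _) =
  subst (l ≤_) (sym (sizeOf-∷ ls 0<l)) (≤-trans (m≤n⊔m (sizeOf ls) l) (n≤1+n _))

piOf-↭ : ∀ ls → All (0 <_) ls → piOf ls ↭ idPerm (sizeOf ls)
piOf-↭ []       _            = ↭-refl
piOf-↭ (l ∷ ls) (0<l ∷ ls>0) =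
  subst₂ _↭_ (sym (piOf-∷ ls 0<l)) (trans (sym (idPerm-suc-⊔ S l)) (cong idPerm (sym (sizeOf-∷ ls 0<l))))
    (↭-trans (insert-↭ l 1 _) (prep 1 (↭-map⁺ suc (↭-++⁺ʳ (interval S (l ∸ S)) (piOf-↭ ls ls>0)))))
  where
  S : ℕ
  S = sizeOf ls

lifted->1 : ∀ ls l → All (0 <_) ls → All (1 <_) (lifted ls l)
lifted->1 ls l ls>0 = All.map⁺ (All.map s≤s
  (All.++⁺ (↭-idPerm-positive (piOf-↭ ls ls>0)) (All.map (≤-trans z<s) (interval-> (sizeOf ls) (l ∸ sizeOf ls)))))

piOf-lastNotFixed : ∀ ls → All (0 <_) ls → last (piOf ls) ≢ just (sizeOf ls)
piOf-lastNotFixed []       _            ()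
piOf-lastNotFixed (l ∷ ls) (0<l ∷ ls>0) last≡
  rewrite piOf-∷ ls 0<l | sizeOf-∷ ls 0<l with sizeOf ls ≤? l
... | yes S≤l = <⇒≢ (≤-trans 0<l (m≤n⊔m (sizeOf ls) l)) (suc-injective (just-injective (begin
    just 1                           ≡⟨ last-insert-end l 1 (lifted ls l) (≤-reflexive |lifted|≡l) ⟨
    last (insert l 1 (lifted ls l))  ≡⟨ last≡ ⟩
    just (suc (sizeOf ls ⊔ l))       ∎)))
  where
  open ≡-Reasoning
  |lifted|≡l : length (lifted ls l) ≡ l
  |lifted|≡l = trans (length-lifted ls l) (m≤n⇒m⊔n≡n S≤l)
... | no S≰l = piOf-lastNotFixed ls ls>0 (map-injective suc-injective (begin
    Maybe.map suc (last (piOf ls))   ≡⟨ last-map suc (piOf ls) ⟨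
    last (map suc (piOf ls))         ≡⟨ cong (λ v → last (map suc v)) (++-identityʳ (piOf ls)) ⟨
    last (map suc (piOf ls ++ []))   ≡⟨ cong (λ k → last (map suc (piOf ls ++ interval S k))) (m≤n⇒m∸n≡0 (<⇒≤ l<S)) ⟨
    last (lifted ls l)               ≡⟨ last-insert-< l 1 (lifted ls l) l<|lifted| ⟨
    last (insert l 1 (lifted ls l))  ≡⟨ last≡ ⟩
    just (suc (S ⊔ l))               ≡⟨ cong (just ∘ suc) (m≥n⇒m⊔n≡m (<⇒≤ l<S)) ⟩
    just (suc S)                     ∎))
  where
  open ≡-Reasoning
  S : ℕ
  S = sizeOf ls
  l<S : l < S
  l<S = ≰⇒> S≰l
  l<|lifted| : l < length (lifted ls l)
  l<|lifted| = subst (l <_) (sym (length-lifted ls l)) (≤-trans l<S (m≤m⊔n S l))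

lifted-drop-ascending : ∀ {l} ls → All (0 <_) ls → largestPart ls ≤ l →
                        AllPairs _≤_ (drop (largestPart ls) (piOf ls)) → AllPairs _≤_ (drop l (lifted ls l))
lifted-drop-ascending {l} ls ls>0 h≤l asc =
  subst (AllPairs _≤_) (sym (drop-map l (piOf ls ++ I)))
    (AllPairs.map⁺ (AllPairs.map s≤s (AllPairs-drop-mono (piOf ls ++ I) h≤l
      (subst (AllPairs _≤_) (sym (drop-++ˡ h (piOf ls) I h≤|π|))
        (AllPairs.++⁺ asc (interval-ascending S (l ∸ S))
          (All.map (λ x≤S → All.map (λ S<y → ≤-trans x≤S (<⇒≤ S<y)) (interval-> S (l ∸ S)))
                   (All.drop⁺ h (↭-idPerm-≤ (piOf-↭ ls ls>0)))))))))
  where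
  S : ℕ
  S = sizeOf ls
  I : List ℕ
  I = interval S (l ∸ S)
  h : ℕ
  h = largestPart ls
  h≤|π| : h ≤ length (piOf ls)
  h≤|π| = subst (h ≤_) (sym (length-piOf ls)) (largestPart-≤-sizeOf ls ls>0)

-- The entry 1 of π(λ) has index λ₁, and from there on π(λ) increases.
piOf-drop-ascending : ∀ ls → All (0 <_) ls → Linked _≥_ ls → AllPairs _≤_ (drop (largestPart ls) (piOf ls))
piOf-drop-ascending []       _            _   = []
piOf-drop-ascending (l ∷ ls) (0<l ∷ ls>0) lnk =
  subst (AllPairs _≤_ ∘ drop l) (sym (piOf-∷ ls 0<l))
    (subst (AllPairs _≤_) (sym (drop-insert l 1 (lifted ls l) (l≤length-lifted l ls)))
       (All.drop⁺ l (All.map <⇒≤ (lifted->1 ls l ls>0))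
        ∷ lifted-drop-ascending ls ls>0 (largestPart-≤ ls lnk) (piOf-drop-ascending ls ls>0 (Linked.tail lnk))))

piOf-avoiding : ∀ ls → All (0 <_) ls → Linked _≥_ ls → Avoiding132 (piOf ls)
piOf-avoiding []       _            _   = []
piOf-avoiding (l ∷ ls) (0<l ∷ ls>0) lnk =
  subst Avoiding132 (sym (piOf-∷ ls 0<l))
    (Avoiding132-insert-min (take l u)
      (subst (All (0 <_)) (sym (take++drop≡id l u)) (All.map <⇒≤ (lifted->1 ls l ls>0)))
      (lifted-drop-ascending ls ls>0 (largestPart-≤ ls lnk) (piOf-drop-ascending ls ls>0 (Linked.tail lnk)))
      (subst Avoiding132 (sym (take++drop≡id l u))
        (Avoiding132-map-suc⁺
          (Avoiding132-++ (piOf-avoiding ls ls>0 (Linked.tail lnk)) (↭-idPerm-≤ (piOf-↭ ls ls>0))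
                          (interval-> S (l ∸ S)) (interval-ascending S (l ∸ S))))))
  where
  S : ℕ
  S = sizeOf ls
  u : List ℕ
  u = lifted ls l

piOf∈S132 : ∀ ls → IsPartition ls → InS132′ (piOf ls)
piOf∈S132 ls (ls>0 , lnk) = record
  { perm         = subst (λ n → piOf ls ↭ idPerm n) (sym (length-piOf ls)) (piOf-↭ ls ls>0)
  ; avoiding     = piOf-avoiding ls ls>0 lnk
  ; lastNotFixed = subst (λ n → last (piOf ls) ≢ just n) (sym (length-piOf ls)) (piOf-lastNotFixed ls ls>0)
  }

-- Every element of 𝔖(132) is some π(λ)

one-in-piOf : ∀ {l} ls → 0 < l → All (0 <_) ls →
              ∃₂ λ A B → piOf (l ∷ ls) ≡ A ++ 1 ∷ B × length A ≡ l × All (1 <_) A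
one-in-piOf {l} ls 0<l ls>0 =
  take l (lifted ls l) , drop l (lifted ls l) , piOf-∷ ls 0<l ,
  trans (length-take l (lifted ls l)) (m≤n⇒m⊓n≡m (l≤length-lifted l ls)) ,
  All.take⁺ l (lifted->1 ls l ls>0)

record FixedTail (n : ℕ) (v : List ℕ) : Set where
  field
    m k               : ℕ
    core              : List ℕ
    split             : v ≡ core ++ interval m k
    m+k≡n             : m + k ≡ n
    core-↭            : core ↭ idPerm m
    core-lastNotFixed : last core ≢ just m

fixedTail : ∀ n v → v ↭ idPerm n → FixedTail n v
fixedTail zero    v v↭ = record
  { m = 0 ; k = 0 ; core = v ; split = sym (++-identityʳ v) ; m+k≡n = refl ; core-↭ = v↭
  ; core-lastNotFixed = subst (λ v → last v ≢ just 0) (sym (↭-empty-inv v↭)) (λ ()) }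
fixedTail (suc n) v v↭ with initLast v
... | [] = ⊥-elim (1+n≢0 (sym (trans (↭-length v↭) (length-idPerm (suc n)))))
... | xs ∷ʳ′ x with x ≟ suc n
...   | no x≢ = record
  { m = suc n ; k = 0 ; core = xs ∷ʳ x ; split = sym (++-identityʳ (xs ∷ʳ x)) ; m+k≡n = +-identityʳ (suc n)
  ; core-↭ = v↭ ; core-lastNotFixed = x≢ ∘ just-injective ∘ trans (sym (last-∷ʳ xs x)) }
...   | yes refl = record
  { m = m ; k = suc k ; core = core ; split = split′ ; m+k≡n = trans (+-suc m k) (cong suc m+k≡n)
  ; core-↭ = core-↭ ; core-lastNotFixed = core-lastNotFixed }
  where
  xs↭ : xs ↭ idPerm n
  xs↭ = subst₂ _↭_ (++-identityʳ xs) (++-identityʳ (idPerm n))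
          (drop-mid xs (idPerm n) (subst (xs ∷ʳ suc n ↭_) (idPerm-∷ʳ n) v↭))
  open FixedTail (fixedTail n xs xs↭)
  split′ : xs ∷ʳ suc n ≡ core ++ interval m (suc k)
  split′ = begin
    xs ∷ʳ suc n                                ≡⟨ cong₂ _∷ʳ_ split (cong suc (sym m+k≡n)) ⟩
    (core ++ interval m k) ∷ʳ suc (m + k)      ≡⟨ ++-assoc core (interval m k) _ ⟩
    core ++ (interval m k ++ interval (m + k) 1) ≡⟨ cong (core ++_) (interval-++ m k 1) ⟨
    core ++ interval m (k + 1)                 ≡⟨ cong (λ j → core ++ interval m j) (+-comm k 1) ⟩
    core ++ interval m (suc k)                 ∎
    where open ≡-Reasoning

ascending-↭-idPerm-last : ∀ {w n} → AllPairs _≤_ w → w ↭ idPerm (suc n) → last w ≡ just (suc n)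
ascending-↭-idPerm-last {w} {n} asc w↭ with initLast w
... | []       = ⊥-elim (1+n≢0 (sym (trans (↭-length w↭) (length-idPerm (suc n)))))
... | xs ∷ʳ′ z = trans (last-∷ʳ xs z) (cong just (≤-antisym z≤ ≤z))
  where
  z≤ : z ≤ suc n
  z≤ = proj₂ (All.∷ʳ⁻ (↭-idPerm-≤ w↭))
  ≤z : suc n ≤ z
  ≤z = All.lookup (All.∷ʳ⁺ (AllPairs-∷ʳ⁻ xs asc) ≤-refl)
         (∈-resp-↭ (↭-sym w↭) (subst (suc n ∈_) (sym (idPerm-∷ʳ n)) (∈-++⁺ʳ (idPerm n) (here refl))))

larger-prefix-length-≤ : ∀ xs {ys} zs {c zs′} → xs ++ ys ≡ zs ++ c ∷ zs′ → All (c <_) zs → AllPairs _≤_ ys →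
                         length zs ≤ length xs
larger-prefix-length-≤ xs       []       _    _            _   = z≤n
larger-prefix-length-≤ []       (z ∷ zs) refl (c<z ∷ _)    (z≤ ∷ _) = ⊥-elim (<⇒≱ c<z (All.head (All.++⁻ʳ zs z≤)))
larger-prefix-length-≤ (x ∷ xs) (z ∷ zs) eq   (_ ∷ c<zs)  asc = s≤s (larger-prefix-length-≤ xs zs (∷-injectiveʳ eq) c<zs asc)

-- If ys ≠ [] the last value of w is one more than that of the lowered word, which therefore has no
-- trailing fixed points to strip; if ys = [] the count follows from the length.
trailing-fixed-points≡ : ∀ xs ys {core m k} → xs ++ ys ≡ map suc (core ++ interval m k) → length (xs ++ ys) ≡ m + k →
                         last (xs ++ 1 ∷ ys) ≢ just (suc (m + k)) → k ≡ length xs ∸ m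
trailing-fixed-points≡ xs [] {m = m} {k} _ len _ =
  sym (trans (cong (_∸ m) (trans (sym (cong length (++-identityʳ xs))) len)) (m+n∸m≡n m k))
trailing-fixed-points≡ xs (y ∷ ys) {m = m} {zero} _ len _ =
  sym (m≤n⇒m∸n≡0 (<⇒≤ (subst (length xs <_) (trans len (+-identityʳ m)) xs-shorter)))
  where
  xs-shorter : length xs < length (xs ++ y ∷ ys)
  xs-shorter = ≤-trans (s≤s (length-++-≤ˡ xs)) (≤-reflexive (sym (length-++-sucʳ xs y ys)))
trailing-fixed-points≡ xs (y ∷ ys) {core} {m} {suc k} eq _ last≢ = ⊥-elim (last≢ (begin
  last (xs ++ 1 ∷ y ∷ ys)                         ≡⟨ last-++-∷ xs (y ∷ ys) ⟩
  last (y ∷ ys)                                   ≡⟨ last-++-∷ xs ys ⟨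
  last (xs ++ y ∷ ys)                             ≡⟨ cong last eq ⟩
  last (map suc (core ++ interval m (suc k)))     ≡⟨ last-map suc (core ++ interval m (suc k)) ⟩
  Maybe.map suc (last (core ++ interval m (suc k))) ≡⟨ cong (Maybe.map suc) (last-++-∷ core (interval (suc m) k)) ⟩
  Maybe.map suc (last (interval m (suc k)))       ≡⟨ cong (Maybe.map suc) (last-interval m k) ⟩
  just (suc (m + suc k))                          ∎))
  where open ≡-Reasoning

record Decomposition (w : List ℕ) : Set where
  field
    l            : ℕ
    rest         : List ℕ
    0<l          : 0 < l
    rest∈S132    : InS132′ rest
    shorter      : length rest < length w
    w≡           : w ≡ insert l 1 (map suc (rest ++ interval (length rest) (l ∸ length rest)))
    one-position : ∀ A B → rest ≡ A ++ 1 ∷ B → All (1 <_) A → length A ≤ l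

delete-one-↭ : ∀ xs {ys} → xs ++ 1 ∷ ys ↭ idPerm (length (xs ++ 1 ∷ ys)) → xs ++ ys ↭ map suc (idPerm (length (xs ++ ys)))
delete-one-↭ xs {ys} w↭ =
  drop-mid xs [] (subst (xs ++ 1 ∷ ys ↭_) (trans (cong idPerm (length-++-sucʳ xs 1 ys)) (idPerm-suc _)) w↭)

↭-map-suc-idPerm->1 : ∀ {xs n} → xs ↭ map suc (idPerm n) → All (1 <_) xs
↭-map-suc-idPerm->1 {n = n} xs↭ = All-resp-↭ (↭-sym xs↭) (All.map⁺ (All.map s≤s (↭-idPerm-positive (↭-refl {x = idPerm n}))))

ascending-after-one : ∀ xs {ys} → Avoiding132 (xs ++ 1 ∷ ys) → All (1 <_) ys → AllPairs _≤_ ys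
ascending-after-one xs av = Avoiding132⇒ascending (Avoiding132-resp-⊆ (Sublist.++⁺ˡ xs ⊆-refl) av)

map-suc-pred : ∀ {xs} → All (0 <_) xs → map suc (map pred xs) ≡ xs
map-suc-pred {xs} xs>0 = trans (sym (map-∘ xs)) (map-id-local (All.map (λ { {suc _} _ → refl }) xs>0))

delete-one-and-lower : ∀ xs {ys} → InS132′ (xs ++ 1 ∷ ys) →
                       Σ (List ℕ) λ v → map suc v ≡ xs ++ ys × v ↭ idPerm (length (xs ++ ys)) × Avoiding132 v
delete-one-and-lower xs {ys} w∈ = v , suc-v , v↭ , v-avoiding
  where
  open InS132′ w∈
  n : ℕ
  n = length (xs ++ ys)
  v : List ℕ
  v = map pred (xs ++ ys)
  xys↭ : xs ++ ys ↭ map suc (idPerm n)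
  xys↭ = delete-one-↭ xs perm
  suc-v : map suc v ≡ xs ++ ys
  suc-v = map-suc-pred (All.map <⇒≤ (↭-map-suc-idPerm->1 xys↭))
  v↭ : v ↭ idPerm n
  v↭ = subst (v ↭_) (trans (sym (map-∘ (idPerm n))) (map-id (idPerm n))) (↭-map⁺ pred xys↭)
  v-avoiding : Avoiding132 v
  v-avoiding = Avoiding132-map-suc⁻ v (subst Avoiding132 (sym suc-v)
                 (Avoiding132-resp-⊆ (Sublist.++⁺ (⊆-refl {x = xs}) (1 Sublist.∷ʳ ⊆-refl)) avoiding))

map-suc-split : ∀ A B zs → map suc ((A ++ 1 ∷ B) ++ zs) ≡ map suc A ++ 2 ∷ map suc (B ++ zs)
map-suc-split A B zs = trans (cong (map suc) (++-assoc A (1 ∷ B) zs)) (map-++ suc A (1 ∷ (B ++ zs)))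

-- The 1 cannot come first: w would then be ascending, hence the identity, whose last point is fixed.
decompose-at : ∀ xs ys → InS132′ (xs ++ 1 ∷ ys) → Decomposition (xs ++ 1 ∷ ys)
decompose-at [] ys w∈ =
  ⊥-elim (lastNotFixed (ascending-↭-idPerm-last (All.map <⇒≤ ys>1 ∷ ascending-after-one [] avoiding ys>1) perm))
  where
  open InS132′ w∈
  ys>1 : All (1 <_) ys
  ys>1 = ↭-map-suc-idPerm->1 (delete-one-↭ [] perm)
decompose-at xs@(_ ∷ _) ys w∈ with delete-one-and-lower xs w∈
... | v , suc-v , v↭ , v-avoiding = record
  { l = length xs ; rest = core ; 0<l = z<s
  ; rest∈S132 = record
    { perm = subst (λ j → core ↭ idPerm j) (sym |core|≡m) core-↭
    ; avoiding = Avoiding132-resp-⊆ (Sublist.++⁺ʳ (interval m k) ⊆-refl) (subst Avoiding132 split v-avoiding)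
    ; lastNotFixed = subst (λ j → last core ≢ just j) (sym |core|≡m) core-lastNotFixed }
  ; shorter = subst₂ _<_ (sym |core|≡m) (sym (length-++-sucʳ xs 1 ys)) (s≤s (subst (m ≤_) m+k≡n (m≤m+n m k)))
  ; w≡ = w≡
  ; one-position = λ A B core≡ A>1 → subst (_≤ length xs) (length-map suc A)
      (larger-prefix-length-≤ xs (map suc A)
        (trans xys≡core (trans (cong (λ c → map suc (c ++ interval m k)) core≡) (map-suc-split A B (interval m k))))
        (All.map⁺ (All.map s≤s A>1)) ys-ascending) }
  where
  open InS132′ w∈
  open FixedTail (fixedTail (length (xs ++ ys)) v v↭)
  |core|≡m : length core ≡ m
  |core|≡m = trans (↭-length core-↭) (length-idPerm m)
  xys≡core : xs ++ ys ≡ map suc (core ++ interval m k)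
  xys≡core = trans (sym suc-v) (cong (map suc) split)
  k≡ : k ≡ length xs ∸ m
  k≡ = trailing-fixed-points≡ xs ys xys≡core (sym m+k≡n)
         (subst (λ j → last (xs ++ 1 ∷ ys) ≢ just j) (trans (length-++-sucʳ xs 1 ys) (cong suc (sym m+k≡n))) lastNotFixed)
  w≡ : xs ++ 1 ∷ ys ≡ insert (length xs) 1 (map suc (core ++ interval (length core) (length xs ∸ length core)))
  w≡ = begin
    xs ++ 1 ∷ ys                                       ≡⟨ insert-++ xs 1 ys ⟨
    insert (length xs) 1 (xs ++ ys)                    ≡⟨ cong (insert (length xs) 1) xys≡core ⟩
    insert (length xs) 1 (map suc (core ++ interval m k))
      ≡⟨ cong (λ j → insert (length xs) 1 (map suc (core ++ interval m j))) k≡ ⟩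
    insert (length xs) 1 (map suc (core ++ interval m (length xs ∸ m)))
      ≡⟨ cong (λ j → insert (length xs) 1 (map suc (core ++ interval j (length xs ∸ j)))) (sym |core|≡m) ⟩
    insert (length xs) 1 (map suc (core ++ interval (length core) (length xs ∸ length core))) ∎
    where open ≡-Reasoning
  ys-ascending : AllPairs _≤_ ys
  ys-ascending = ascending-after-one xs avoiding (All.++⁻ʳ xs (↭-map-suc-idPerm->1 (delete-one-↭ xs perm)))

decompose : ∀ {x xs} → InS132′ (x ∷ xs) → Decomposition (x ∷ xs)
decompose {x} {xs} w∈ with ∈-∃++ (∈-resp-↭ (↭-sym (subst (x ∷ xs ↭_) (idPerm-suc (length xs)) (InS132′.perm w∈))) (here refl))
... | ys , zs , w≡ = subst Decomposition (sym w≡) (decompose-at ys zs (subst InS132′ w≡ w∈))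

PartitionOf : List ℕ → Set
PartitionOf w = Σ (List ℕ) (λ λs → IsPartition λs × piOf λs ≡ w)

addLargestPart : ∀ {w} (D : Decomposition w) → PartitionOf (Decomposition.rest D) → PartitionOf w
addLargestPart {w} D (λs , (λs>0 , lnk) , π≡) = l ∷ λs , (0<l ∷ λs>0 , largestPart-≤l λs λs>0 π≡ ∷′ lnk) , piOf≡w
  where
  open Decomposition D
  largestPart-≤l : ∀ λs → All (0 <_) λs → piOf λs ≡ rest → largestPart λs ≤ l
  largestPart-≤l []         _                 _  = z≤n
  largestPart-≤l (l′ ∷ λs′) (0<l′ ∷ λs′>0) π≡ with one-in-piOf λs′ 0<l′ λs′>0
  ... | A , B , π≡A1B , |A|≡l′ , A>1 = subst (_≤ l) |A|≡l′ (one-position A B (trans (sym π≡) π≡A1B) A>1)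
  _∷′_ : ∀ {λs} → largestPart λs ≤ l → Linked _≥_ λs → Linked _≥_ (l ∷ λs)
  _∷′_ {[]}    _     _   = [-]
  _∷′_ {_ ∷ _} l′≤l lnk = l′≤l ∷ lnk
  piOf≡w : piOf (l ∷ λs) ≡ w
  piOf≡w = begin
    piOf (l ∷ λs)                                                            ≡⟨ piOf-∷ λs 0<l ⟩
    insert l 1 (map suc (piOf λs ++ interval (sizeOf λs) (l ∸ sizeOf λs)))
      ≡⟨ cong₂ (λ v S → insert l 1 (map suc (v ++ interval S (l ∸ S)))) π≡ (trans (sym (length-piOf λs)) (cong length π≡)) ⟩
    insert l 1 (map suc (rest ++ interval (length rest) (l ∸ length rest)))   ≡⟨ w≡ ⟨
    w                                                                        ∎
    where open ≡-Reasoning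

partitionOf : ∀ w → Acc _<_ (length w) → InS132′ w → PartitionOf w
partitionOf []       _         _  = [] , ([] , []) , refl
partitionOf (x ∷ xs) (acc rec) w∈ = addLargestPart D (partitionOf rest (rec shorter) rest∈S132)
  where
  D : Decomposition (x ∷ xs)
  D = decompose w∈
  open Decomposition D

lemma5p27 : (w : List ℕ) →
    InS132 w ⇔ Σ (List ℕ) (λ λs → IsPartition λs × piOf λs ≡ w)
lemma5p27 w = mk⇔
  (λ w∈ → partitionOf w (<-wellFounded (length w)) (Equivalence.to (InS132⇔InS132′ w) w∈))
  (λ (λs , λs-part , π≡) → subst InS132 π≡ (Equivalence.from (InS132⇔InS132′ (piOf λs)) (piOf∈S132 λs λs-part)))
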